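{- Every directed cycle $C$ of length at least $3$ satisfies $\dim(C)\in\{3,4\}$, and both values occur (there are directed cycles with weak majority dimension $3$ and directed cycles with weak majority dimension $4$).
   Context: All digraphs are finite and have simple underlying graphs (so directed cycles have length at least $3$). A directed cycle of length $n$ is a digraph $v_1\to v_2\to\cdots\to v_n\to v_1$ with arc set exactly $\{(v_i,v_{i+1}):1\le i<n\}\cup\{(v_n,v_1)\}$. For an integer $d\ge 0$ write $[d]=\{1,\dots,d\}$ (with $\mathbb{R}^0=\{0\}$). For $x,y\in\mathbb{R}^d$ let $\mathcal{G}_{x>y}=\{i\in[d]: x_i>y_i\}$. The weak majority relation: $x\succ y$ iff $|\mathcal{G}_{x>y}|-|\mathcal{G}_{y>x}|>0$. A map $f:V(D)\to\mathbb{R}^d$ is an $\mathbb{R}^d$-realizer of $D$ if for all vertices $x,y$: $(x,y)\in A(D)$ iff $f(x)\succ f(y)$. The weak majority dimension $\dim(D)$ is the minimum nonnegative integer $d$ such that $D$ has an $\mathbb{R}^d$-realizer (such $d$ always exists).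
   Formalization: Realizers take values in ℚ^d rather than ℝ^d, so the weak majority dimension is the least d for which a directed cycle has a rational realizer. -}

module Defs where

open import Data.Nat using (ℕ; zero; suc; _+_; _∸_; _≤_)
import Data.Nat as ℕ
open import Data.Fin using (Fin; toℕ)
import Data.Fin as Fin
open import Data.Rational using (ℚ)
import Data.Rational as ℚ
open import Data.Rational.Properties using (_<?_)
open import Data.Bool using (if_then_else_)
open import Data.Product using (_×_; Σ)
open import Data.Sum using (_⊎_)
open import Relation.Nullary.Decidable using (⌊_⌋)
open import Relation.Binary.PropositionalEquality using (_≡_)

Digraph : ℕ → Set₁
Digraph n = Fin n → Fin n → Set

Point : ℕ → Set
Point d = Fin d → ℚ

countGt : ∀ {d} → Point d → Point d → ℕ
countGt {zero}  x y = 0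
countGt {suc d} x y =
  (if ⌊ y Fin.zero <? x Fin.zero ⌋ then 1 else 0) + countGt (λ i → x (Fin.suc i)) (λ i → y (Fin.suc i))

_≻_ : ∀ {d} → Point d → Point d → Set
x ≻ y = countGt y x ℕ.< countGt x y

IsRealizer : ∀ {n} → Digraph n → (d : ℕ) → (Fin n → Point d) → Set
IsRealizer {n} D d f = (x y : Fin n) → (D x y → f x ≻ f y) × (f x ≻ f y → D x y)

HasRealizer : ∀ {n} → Digraph n → ℕ → Set
HasRealizer {n} D d = Σ (Fin n → Point d) (IsRealizer D d)

DimIs : ∀ {n} → Digraph n → ℕ → Set
DimIs D d = HasRealizer D d × ((d' : ℕ) → HasRealizer D d' → d ≤ d')

Cycle : (n : ℕ) → Digraph n
Cycle n i j = (toℕ j ≡ suc (toℕ i)) ⊎ ((toℕ i ≡ n ∸ 1) × (toℕ j ≡ 0))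

-- In dimension at most two the weak majority relation is strict Pareto dominance: x ≻ y forces
-- x ≥ y in every coordinate, so ≻ is transitive and cannot contain a directed cycle. Hence every
-- cycle has dimension at least 3. Conversely every cycle is realized in ℚ⁴: the points
-- (−2k, −2k, 2⌊k/2⌋, 2⌈k/2⌉) form a staircase in which consecutive points win 2 : 1 and all other
-- pairs tie 2 : 2, and one or two further points, chosen according to the parity of the length,
-- close this path into a cycle. C₃ is realized in ℚ³ by the three rotations of (0, 1, 2). C₅ is
-- not: the coordinatewise comparisons of a realizer in ℚ³ would form a coherent pattern of signs,
-- and a finite search shows that no such pattern exists. Finally, a realizer only matters through
-- the coordinatewise order types of its points, so realizability in a given dimension is
-- decidable; this decides between 3 and 4 for every cycle.

module Submission where

open import Defs
open import Data.Bool using (Bool; true; false; T; if_then_else_; _∧_; _∨_)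
open import Data.Bool.Properties using (∨-identityʳ; ∧-zeroʳ)
open import Data.Fin using (Fin; toℕ; fromℕ<; #_) renaming (zero to fzero; suc to fsuc)
import Data.Fin.Properties as Fin
open import Data.Fin.Subset using (Subset; inside; outside; _∈_; ∣_∣)
open import Data.Fin.Subset.Properties using (p⊂q⇒∣p∣<∣q∣; ∣p∣≤n)
open import Data.Integer as ℤ using (+_)
import Data.Integer.Properties as ℤ
open import Data.Nat as ℕ
  using (ℕ; zero; suc; _+_; _*_; _%_; _∸_; _<_; _≤_; _≥_; _<ᵇ_; _≡ᵇ_; z≤n; s≤s)
import Data.Nat.Properties as ℕ
open import Data.Product using (Σ; _×_; _,_; proj₁; proj₂; map₂; ∃; Σ-syntax)
open import Data.Rational as ℚ using (ℚ)
open import Data.Rational.Literals using (fromℤ)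
import Data.Rational.Properties as ℚ
open import Data.Sum as Sum using (_⊎_; inj₁; inj₂)
open import Data.Unit using (⊤; tt)
open import Data.Vec using (Vec; []; _∷_; tabulate; lookup)
import Data.Vec.Properties as Vec
open import Function using (_∘_; _⇔_; mk⇔; Equivalence)
open import Relation.Binary using (Transitive; tri<; tri≈; tri>)
open import Relation.Binary.PropositionalEquality
  using (_≡_; _≢_; refl; sym; trans; cong; cong₂; subst; subst₂; module ≡-Reasoning)
open import Relation.Nullary using (¬_; Dec; yes; no; does; proof; contradiction)
open import Relation.Nullary.Decidable
  using ( ⌊_⌋; _×-dec_; _⊎-dec_; _→-dec_; map′; True; False; toWitness; toWitnessFalse
        ; from-yes; from-no; isYes≗does; dec-true; dec-false)
open import Relation.Nullary.Reflects using (Reflects; ofʸ; ofⁿ)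

-- Comparison signs

data Comparison : Set where
  less equal greater : Comparison

_≟_ : (s t : Comparison) → Dec (s ≡ t)
less    ≟ less    = yes refl
equal   ≟ equal   = yes refl
greater ≟ greater = yes refl
less    ≟ equal   = no λ ()
less    ≟ greater = no λ ()
equal   ≟ less    = no λ ()
equal   ≟ greater = no λ ()
greater ≟ less    = no λ ()
greater ≟ equal   = no λ ()

data CompareSpec {A : Set} (_≺_ : A → A → Set) (a b : A) : Comparison → Set where
  is-less    : a ≺ b → CompareSpec _≺_ a b less
  is-equal   : a ≡ b → CompareSpec _≺_ a b equal
  is-greater : b ≺ a → CompareSpec _≺_ a b greater

CompareSpec-unique : ∀ {A : Set} {_≺_ : A → A → Set} → (∀ {a} → ¬ a ≺ a) → (∀ {a b} → a ≺ b → ¬ b ≺ a) →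
                     ∀ {a b s t} → CompareSpec _≺_ a b s → CompareSpec _≺_ a b t → s ≡ t
CompareSpec-unique irr asym (is-less _)      (is-less _)      = refl
CompareSpec-unique irr asym (is-less a≺b)    (is-equal refl)  = contradiction a≺b irr
CompareSpec-unique irr asym (is-less a≺b)    (is-greater b≺a) = contradiction b≺a (asym a≺b)
CompareSpec-unique irr asym (is-equal refl)  (is-less a≺a)    = contradiction a≺a irr
CompareSpec-unique irr asym (is-equal _)     (is-equal _)     = refl
CompareSpec-unique irr asym (is-equal refl)  (is-greater a≺a) = contradiction a≺a irr
CompareSpec-unique irr asym (is-greater b≺a) (is-less a≺b)    = contradiction b≺a (asym a≺b)
CompareSpec-unique irr asym (is-greater b≺a) (is-equal refl)  = contradiction b≺a irr
CompareSpec-unique irr asym (is-greater _)   (is-greater _)   = refl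

compareℚ : ℚ → ℚ → Comparison
compareℚ p q with ℚ.<-cmp p q
... | tri< _ _ _ = less
... | tri≈ _ _ _ = equal
... | tri> _ _ _ = greater

compareℚ-spec : ∀ p q → CompareSpec ℚ._<_ p q (compareℚ p q)
compareℚ-spec p q with ℚ.<-cmp p q
... | tri< p<q _ _ = is-less p<q
... | tri≈ _ p≡q _ = is-equal p≡q
... | tri> _ _ q<p = is-greater q<p

compareℚ-unique : ∀ {p q s} → CompareSpec ℚ._<_ p q s → compareℚ p q ≡ s
compareℚ-unique {p} {q} = CompareSpec-unique (ℚ.<-irrefl refl) ℚ.<-asym (compareℚ-spec p q)

-- Structural, so that comparing translates of known points reduces by computation.
compareℕ : ℕ → ℕ → Comparison
compareℕ zero    zero    = equal
compareℕ zero    (suc _) = less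
compareℕ (suc _) zero    = greater
compareℕ (suc m) (suc n) = compareℕ m n

compareℕ-spec : ∀ m n → CompareSpec _<_ m n (compareℕ m n)
compareℕ-spec zero    zero    = is-equal refl
compareℕ-spec zero    (suc n) = is-less ℕ.z<s
compareℕ-spec (suc m) zero    = is-greater ℕ.z<s
compareℕ-spec (suc m) (suc n) with compareℕ m n | compareℕ-spec m n
... | _ | is-less m<n    = is-less (ℕ.s<s m<n)
... | _ | is-equal refl  = is-equal refl
... | _ | is-greater n<m = is-greater (ℕ.s<s n<m)

compareℕ-unique : ∀ {m n s} → CompareSpec _<_ m n s → compareℕ m n ≡ s
compareℕ-unique {m} {n} = CompareSpec-unique (ℕ.<-irrefl refl) ℕ.<-asym (compareℕ-spec m n)

compareℕ-refl : ∀ n → compareℕ n n ≡ equal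
compareℕ-refl n = compareℕ-unique {n} (is-equal refl)

ι : ℕ → ℚ
ι n = fromℤ (+ n)

ι-mono-< : ∀ {m n} → m < n → ι m ℚ.< ι n
ι-mono-< {m} {n} m<n =
  ℚ.*<* (subst₂ ℤ._<_ (sym (ℤ.*-identityʳ (+ m))) (sym (ℤ.*-identityʳ (+ n))) (ℤ.+<+ m<n))

compareℚ-ι : ∀ m n → compareℚ (ι m) (ι n) ≡ compareℕ m n
compareℚ-ι m n with compareℕ m n | compareℕ-spec m n
... | _ | is-less m<n    = compareℚ-unique (is-less (ι-mono-< m<n))
... | _ | is-equal refl  = compareℚ-unique (is-equal refl)
... | _ | is-greater n<m = compareℚ-unique (is-greater (ι-mono-< n<m))

compareℚ-−ι : ∀ m n → compareℚ (ℚ.- ι m) (ℚ.- ι n) ≡ compareℕ n m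
compareℚ-−ι m n with compareℕ n m | compareℕ-spec n m
... | _ | is-less n<m    = compareℚ-unique (is-less (ℚ.neg-antimono-< (ι-mono-< n<m)))
... | _ | is-equal refl  = compareℚ-unique (is-equal refl)
... | _ | is-greater m<n = compareℚ-unique (is-greater (ℚ.neg-antimono-< (ι-mono-< m<n)))

Signs : ℕ → Set
Signs = Vec Comparison

signs : ∀ {d} → Point d → Point d → Signs d
signs x y = tabulate (λ i → compareℚ (x i) (y i))

#less #greater : ∀ {d} → Signs d → ℕ
#less []               = 0
#less (less ∷ s)       = suc (#less s)
#less (equal ∷ s)      = #less s
#less (greater ∷ s)    = #less s
#greater []            = 0
#greater (less ∷ s)    = #greater s
#greater (equal ∷ s)   = #greater s
#greater (greater ∷ s) = suc (#greater s)

countGt≡#greater : ∀ {d} (x y : Point d) → countGt x y ≡ #greater (signs x y)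
countGt≡#greater {zero}  x y = refl
countGt≡#greater {suc d} x y with compareℚ (x fzero) (y fzero) | compareℚ-spec (x fzero) (y fzero)
... | less | is-less x<y
  rewrite isYes≗does (y fzero ℚ.<? x fzero) | dec-false (y fzero ℚ.<? x fzero) (ℚ.<-asym x<y)
  = countGt≡#greater (x ∘ fsuc) (y ∘ fsuc)
... | equal | is-equal x≡y
  rewrite isYes≗does (y fzero ℚ.<? x fzero) | dec-false (y fzero ℚ.<? x fzero) (ℚ.<-irrefl (sym x≡y))
  = countGt≡#greater (x ∘ fsuc) (y ∘ fsuc)
... | greater | is-greater y<x
  rewrite isYes≗does (y fzero ℚ.<? x fzero) | dec-true (y fzero ℚ.<? x fzero) y<x
  = cong suc (countGt≡#greater (x ∘ fsuc) (y ∘ fsuc))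

countGt≡#less : ∀ {d} (x y : Point d) → countGt y x ≡ #less (signs x y)
countGt≡#less {zero}  x y = refl
countGt≡#less {suc d} x y with compareℚ (x fzero) (y fzero) | compareℚ-spec (x fzero) (y fzero)
... | less | is-less x<y
  rewrite isYes≗does (x fzero ℚ.<? y fzero) | dec-true (x fzero ℚ.<? y fzero) x<y
  = cong suc (countGt≡#less (x ∘ fsuc) (y ∘ fsuc))
... | equal | is-equal x≡y
  rewrite isYes≗does (x fzero ℚ.<? y fzero) | dec-false (x fzero ℚ.<? y fzero) (ℚ.<-irrefl x≡y)
  = countGt≡#less (x ∘ fsuc) (y ∘ fsuc)
... | greater | is-greater y<x
  rewrite isYes≗does (x fzero ℚ.<? y fzero) | dec-false (x fzero ℚ.<? y fzero) (ℚ.<-asym y<x)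
  = countGt≡#less (x ∘ fsuc) (y ∘ fsuc)

Beats Loses Tied : ∀ {d} → Signs d → Set
Beats s = #less s < #greater s
Loses s = #greater s < #less s
Tied  s = #less s ≡ #greater s

≻⇔Beats : ∀ {d} (x y : Point d) → x ≻ y ⇔ Beats (signs x y)
≻⇔Beats x y = mk⇔ (subst₂ _<_ (countGt≡#less x y) (countGt≡#greater x y))
                  (subst₂ _<_ (sym (countGt≡#less x y)) (sym (countGt≡#greater x y)))

≺⇔Loses : ∀ {d} (x y : Point d) → y ≻ x ⇔ Loses (signs x y)
≺⇔Loses x y = mk⇔ (subst₂ _<_ (countGt≡#greater x y) (countGt≡#less x y))
                  (subst₂ _<_ (sym (countGt≡#greater x y)) (sym (countGt≡#less x y)))

≻-by-signs : ∀ {d} {x y x′ y′ : Point d} → signs x′ y′ ≡ signs x y → x ≻ y → x′ ≻ y′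
≻-by-signs {x = x} {y} {x′} {y′} same x≻y =
  Equivalence.from (≻⇔Beats x′ y′) (subst Beats (sym same) (Equivalence.to (≻⇔Beats x y) x≻y))

realizer-transfer : ∀ {n d} {D : Digraph n} {f g : Fin n → Point d} →
                    (∀ i j → signs (g i) (g j) ≡ signs (f i) (f j)) → IsRealizer D d f → IsRealizer D d g
realizer-transfer same realizes i j =
  ≻-by-signs (same i j) ∘ proj₁ (realizes i j) , proj₂ (realizes i j) ∘ ≻-by-signs (sym (same i j))

-- Coherent s t u: u is a possible value of compare a c when s = compare a b and t = compare b c.
Coherent : Comparison → Comparison → Comparison → Set
Coherent less    greater _ = ⊤
Coherent greater less    _ = ⊤
Coherent equal   t       u = u ≡ t
Coherent less    _       u = u ≡ less
Coherent greater _       u = u ≡ greater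

Coherentᵛ : ∀ {d} → Signs d → Signs d → Signs d → Set
Coherentᵛ []      []      []      = ⊤
Coherentᵛ (a ∷ s) (b ∷ t) (c ∷ u) = Coherent a b c × Coherentᵛ s t u

compareℚ-coherent : ∀ p q r → Coherent (compareℚ p q) (compareℚ q r) (compareℚ p r)
compareℚ-coherent p q r with compareℚ p q | compareℚ-spec p q | compareℚ q r | compareℚ-spec q r
... | less    | is-less p<q    | less    | is-less q<r    = compareℚ-unique (is-less (ℚ.<-trans p<q q<r))
... | less    | is-less p<q    | equal   | is-equal refl  = compareℚ-unique (is-less p<q)
... | less    | is-less _      | greater | is-greater _   = tt
... | equal   | is-equal refl  | _       | spec           = compareℚ-unique spec
... | greater | is-greater _   | less    | is-less _      = tt
... | greater | is-greater q<p | equal   | is-equal refl  = compareℚ-unique (is-greater q<p)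
... | greater | is-greater q<p | greater | is-greater r<q = compareℚ-unique (is-greater (ℚ.<-trans r<q q<p))

signs-coherent : ∀ {d} (x y z : Point d) → Coherentᵛ (signs x y) (signs y z) (signs x z)
signs-coherent {zero}  x y z = tt
signs-coherent {suc d} x y z =
  compareℚ-coherent (x fzero) (y fzero) (z fzero) , signs-coherent (x ∘ fsuc) (y ∘ fsuc) (z ∘ fsuc)

-- Dimension at most two

#less+#greater≤ : ∀ {d} (s : Signs d) → #less s + #greater s ≤ d
#less+#greater≤ []                    = z≤n
#less+#greater≤ (less ∷ s)            = s≤s (#less+#greater≤ s)
#less+#greater≤ (equal ∷ s)           = ℕ.m≤n⇒m≤1+n (#less+#greater≤ s)
#less+#greater≤ {suc d} (greater ∷ s) =
  subst (_≤ suc d) (sym (ℕ.+-suc (#less s) (#greater s))) (s≤s (#less+#greater≤ s))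

Beats⇒#less≡0 : ∀ {d} (s : Signs d) → d ≤ 2 → Beats s → #less s ≡ 0
Beats⇒#less≡0 s d≤2 l<g with #less s | #greater s | #less+#greater≤ s
... | zero  | _ | _     = refl
... | suc l | g | l+g≤d =
  contradiction (ℕ.≤-trans (ℕ.+-mono-≤ (s≤s z≤n) l<g) (ℕ.≤-trans l+g≤d d≤2)) λ { (s≤s (s≤s ())) }

coherent-without-less : ∀ {d} (s t u : Signs d) → #less s ≡ 0 → #less t ≡ 0 → Coherentᵛ s t u →
                        #less u ≡ 0 × #greater s ≤ #greater u
coherent-without-less []            []            []      _  _  _ = refl , z≤n
coherent-without-less (less ∷ _)    _             _       () _  _
coherent-without-less (equal ∷ _)   (less ∷ _)    _       _  () _
coherent-without-less (greater ∷ _) (less ∷ _)    _       _  () _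
coherent-without-less (equal ∷ s)   (equal ∷ t)   (_ ∷ u) s⁰ t⁰ (refl , c) =
  coherent-without-less s t u s⁰ t⁰ c
coherent-without-less (equal ∷ s)   (greater ∷ t) (_ ∷ u) s⁰ t⁰ (refl , c) =
  map₂ ℕ.m≤n⇒m≤1+n (coherent-without-less s t u s⁰ t⁰ c)
coherent-without-less (greater ∷ s) (equal ∷ t)   (_ ∷ u) s⁰ t⁰ (refl , c) =
  map₂ s≤s (coherent-without-less s t u s⁰ t⁰ c)
coherent-without-less (greater ∷ s) (greater ∷ t) (_ ∷ u) s⁰ t⁰ (refl , c) =
  map₂ s≤s (coherent-without-less s t u s⁰ t⁰ c)

≻-trans-≤2 : ∀ {d} {x y z : Point d} → d ≤ 2 → x ≻ y → y ≻ z → x ≻ z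
≻-trans-≤2 {x = x} {y} {z} d≤2 x≻y y≻z = Equivalence.from (≻⇔Beats x z) (begin-strict
  #less (signs x z)    ≡⟨ proj₁ xz ⟩
  0                    <⟨ subst (_< #greater (signs x y)) xy⁰ xy ⟩
  #greater (signs x y) ≤⟨ proj₂ xz ⟩
  #greater (signs x z) ∎)
  where
  open ℕ.≤-Reasoning
  xy : Beats (signs x y)
  xy = Equivalence.to (≻⇔Beats x y) x≻y
  xy⁰ : #less (signs x y) ≡ 0
  xy⁰ = Beats⇒#less≡0 (signs x y) d≤2 xy
  yz⁰ : #less (signs y z) ≡ 0
  yz⁰ = Beats⇒#less≡0 (signs y z) d≤2 (Equivalence.to (≻⇔Beats y z) y≻z)
  xz : #less (signs x z) ≡ 0 × #greater (signs x y) ≤ #greater (signs x z)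
  xz = coherent-without-less (signs x y) (signs y z) (signs x z) xy⁰ yz⁰ (signs-coherent x y z)

cycle-closes : ∀ {m} (_R_ : Fin (suc (suc m)) → Fin (suc (suc m)) → Set) → Transitive _R_ →
               (∀ i j → Cycle (suc (suc m)) i j → i R j) → fzero R fzero
cycle-closes {m} _R_ R-trans arc = R-trans (reach m m<) (arc _ fzero (inj₂ (Fin.toℕ-fromℕ< m< , refl)))
  where
  m< : suc m < suc (suc m)
  m< = ℕ.n<1+n (suc m)
  reach : ∀ k (k< : suc k < suc (suc m)) → fzero R fromℕ< k<
  reach zero    k< = arc fzero _ (inj₁ (Fin.toℕ-fromℕ< k<))
  reach (suc k) k< =
    R-trans (reach k k<′) (arc _ _ (inj₁ (trans (Fin.toℕ-fromℕ< k<) (cong suc (sym (Fin.toℕ-fromℕ< k<′))))))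
    where
    k<′ : suc k < suc (suc m)
    k<′ = ℕ.<-trans (ℕ.n<1+n (suc k)) k<

cycle-dim≥3 : ∀ {n d} → 2 ≤ n → HasRealizer (Cycle n) d → 3 ≤ d
cycle-dim≥3 {suc (suc m)} {d} _ (f , realizes) with 3 ℕ.≤? d
... | yes 3≤d = 3≤d
... | no 3≰d  = contradiction (cycle-closes (λ i j → f i ≻ f j) (≻-trans-≤2 (ℕ.≤-pred (ℕ.≰⇒> 3≰d)))
                                            (λ i j → proj₁ (realizes i j)))
                             (ℕ.<-irrefl refl)
cycle-dim≥3 {suc zero} (s≤s ())

-- Deciding realizability

Searchable : Set → Set₁
Searchable A = ∀ {P : A → Set} → (∀ a → Dec (P a)) → Dec (∃ P)

search-Vec : ∀ {A} → Searchable A → ∀ n → Searchable (Vec A n)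
search-Vec search zero    P? = map′ ([] ,_) (λ { ([] , p) → p }) (P? [])
search-Vec search (suc n) P? =
  map′ (λ { (a , v , p) → a ∷ v , p }) (λ { (a ∷ v , p) → a , v , p })
       (search (λ a → search-Vec search n (λ v → P? (a ∷ v))))

module Rank {n} (v : Fin n → ℚ) where

  below : ℚ → Subset n
  below a = tabulate (λ l → if ⌊ v l ℚ.<? a ⌋ then inside else outside)

  ∈-below⁺ : ∀ {a l} → v l ℚ.< a → l ∈ below a
  ∈-below⁺ {a} {l} vl<a = Vec.lookup⇒[]= l (below a) (begin
    lookup (below a) l                           ≡⟨ Vec.lookup∘tabulate _ l ⟩
    (if ⌊ v l ℚ.<? a ⌋ then inside else outside) ≡⟨ cong (if_then inside else outside) vl<?a ⟩
    inside                                       ∎)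
    where
    open ≡-Reasoning
    vl<?a : ⌊ v l ℚ.<? a ⌋ ≡ true
    vl<?a = trans (isYes≗does (v l ℚ.<? a)) (dec-true (v l ℚ.<? a) vl<a)

  ∈-below⁻ : ∀ {a l} → l ∈ below a → v l ℚ.< a
  ∈-below⁻ {a} {l} l∈ with v l ℚ.<? a | trans (sym (Vec.lookup∘tabulate _ l)) (Vec.[]=⇒lookup l∈)
  ... | yes vl<a | _ = vl<a
  ... | no _     | ()

  rank : Fin n → ℕ
  rank i = ∣ below (v i) ∣

  rank-mono-< : ∀ {i j} → v i ℚ.< v j → rank i < rank j
  rank-mono-< {i} {j} vi<vj = p⊂q⇒∣p∣<∣q∣
    ( (λ l∈ → ∈-below⁺ (ℚ.<-trans (∈-below⁻ l∈) vi<vj))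
    , i , ∈-below⁺ vi<vj , λ i∈ → ℚ.<-irrefl refl (∈-below⁻ i∈))

  rank-bounded : ∀ i → rank i < suc n
  rank-bounded i = s≤s (∣p∣≤n (below (v i)))

  compareℕ-rank : ∀ i j → compareℕ (rank i) (rank j) ≡ compareℚ (v i) (v j)
  compareℕ-rank i j with compareℚ (v i) (v j) | compareℚ-spec (v i) (v j)
  ... | _ | is-less vi<vj    = compareℕ-unique (is-less (rank-mono-< vi<vj))
  ... | _ | is-equal vi≡vj   = compareℕ-unique (is-equal (cong (∣_∣ ∘ below) vi≡vj))
  ... | _ | is-greater vj<vi = compareℕ-unique (is-greater (rank-mono-< vj<vi))

RankTable : ℕ → ℕ → Set
RankTable n d = Vec (Vec (Fin (suc n)) d) n

ranked : ∀ {n d} → RankTable n d → Fin n → Point d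
ranked t i c = ι (toℕ (lookup (lookup t i) c))

realizer-by-ranks : ∀ {n d} {D : Digraph n} {f : Fin n → Point d} → IsRealizer D d f →
                    Σ[ t ∈ RankTable n d ] IsRealizer D d (ranked t)
realizer-by-ranks {n} {d} {f = f} realizes = t , realizer-transfer same-signs realizes
  where
  rank : Fin d → Fin n → ℕ
  rank c = Rank.rank (λ i → f i c)
  t : RankTable n d
  t = tabulate λ i → tabulate λ c → fromℕ< (Rank.rank-bounded (λ i → f i c) i)
  ranked-t : ∀ i c → ranked t i c ≡ ι (rank c i)
  ranked-t i c = cong ι (begin
    toℕ (lookup (lookup t i) c) ≡⟨ cong (λ r → toℕ (lookup r c)) (Vec.lookup∘tabulate _ i) ⟩
    toℕ (lookup (tabulate _) c) ≡⟨ cong toℕ (Vec.lookup∘tabulate _ c) ⟩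
    toℕ (fromℕ< _)              ≡⟨ Fin.toℕ-fromℕ< _ ⟩
    rank c i                    ∎)
    where open ≡-Reasoning
  same-signs : ∀ i j → signs (ranked t i) (ranked t j) ≡ signs (f i) (f j)
  same-signs i j = Vec.tabulate-cong λ c → begin
    compareℚ (ranked t i c) (ranked t j c) ≡⟨ cong₂ compareℚ (ranked-t i c) (ranked-t j c) ⟩
    compareℚ (ι (rank c i)) (ι (rank c j)) ≡⟨ compareℚ-ι (rank c i) (rank c j) ⟩
    compareℕ (rank c i) (rank c j)         ≡⟨ Rank.compareℕ-rank (λ i → f i c) i j ⟩
    compareℚ (f i c) (f j c)               ∎
    where open ≡-Reasoning

_≻?_ : ∀ {d} (x y : Point d) → Dec (x ≻ y)
x ≻? y = countGt y x ℕ.<? countGt x y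

realizes? : ∀ {n} {D : Digraph n} → (∀ i j → Dec (D i j)) → ∀ d f → Dec (IsRealizer D d f)
realizes? D? d f =
  Fin.all? λ i → Fin.all? λ j → (D? i j →-dec (f i ≻? f j)) ×-dec ((f i ≻? f j) →-dec D? i j)

hasRealizer? : ∀ {n} {D : Digraph n} → (∀ i j → Dec (D i j)) → ∀ d → Dec (HasRealizer D d)
hasRealizer? {n} D? d =
  map′ (λ (t , realizes) → ranked t , realizes) (λ (f , realizes) → realizer-by-ranks realizes)
       (search-Vec (search-Vec Fin.any? d) n λ t → realizes? D? d (ranked t))

Cycle? : ∀ n (i j : Fin n) → Dec (Cycle n i j)
Cycle? n i j = (toℕ j ℕ.≟ suc (toℕ i)) ⊎-dec ((toℕ i ℕ.≟ n ∸ 1) ×-dec (toℕ j ℕ.≟ 0))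

-- C₅ in dimension three

search-Comparison : Searchable Comparison
search-Comparison {P} P? = map′ to from (P? less ⊎-dec (P? equal ⊎-dec P? greater))
  where
  to : P less ⊎ (P equal ⊎ P greater) → ∃ P
  to (inj₁ p)        = less , p
  to (inj₂ (inj₁ p)) = equal , p
  to (inj₂ (inj₂ p)) = greater , p
  from : ∃ P → P less ⊎ (P equal ⊎ P greater)
  from (less , p)    = inj₁ p
  from (equal , p)   = inj₂ (inj₁ p)
  from (greater , p) = inj₂ (inj₂ p)

coherent? : ∀ s t u → Dec (Coherent s t u)
coherent? less    greater _ = yes tt
coherent? greater less    _ = yes tt
coherent? equal   t       u = u ≟ t
coherent? less    less    u = u ≟ less
coherent? less    equal   u = u ≟ less
coherent? greater equal   u = u ≟ greater
coherent? greater greater u = u ≟ greater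

coherentᵛ? : ∀ {d} (s t u : Signs d) → Dec (Coherentᵛ s t u)
coherentᵛ? []      []      []      = yes tt
coherentᵛ? (a ∷ s) (b ∷ t) (c ∷ u) = coherent? a b c ×-dec coherentᵛ? s t u

Beats? : ∀ {d} (s : Signs d) → Dec (Beats s)
Beats? s = #less s ℕ.<? #greater s

Loses? : ∀ {d} (s : Signs d) → Dec (Loses s)
Loses? s = #greater s ℕ.<? #less s

Tied? : ∀ {d} (s : Signs d) → Dec (Tied s)
Tied? s = #less s ℕ.≟ #greater s

-- sᵢⱼ plays the role of signs (f i) (f j) for a realizer f of C₅ in ℚ³. Each constraint is placed
-- right after its last sign is chosen, which keeps the exhaustive search of C₅Pattern? small.
C₅Pattern : Set
C₅Pattern =
  Σ[ s13 ∈ Signs 3 ] Tied s13 ×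
  Σ[ s03 ∈ Signs 3 ] Tied s03 ×
  Σ[ s01 ∈ Signs 3 ] Beats s01 × Coherentᵛ s01 s13 s03 ×
  Σ[ s12 ∈ Signs 3 ] Beats s12 ×
  Σ[ s02 ∈ Signs 3 ] Tied s02 × Coherentᵛ s01 s12 s02 ×
  Σ[ s23 ∈ Signs 3 ] Beats s23 × Coherentᵛ s02 s23 s03 × Coherentᵛ s12 s23 s13 ×
  Σ[ s04 ∈ Signs 3 ] Loses s04 ×
  Σ[ s14 ∈ Signs 3 ] Tied s14 × Coherentᵛ s01 s14 s04 ×
  Σ[ s34 ∈ Signs 3 ] Beats s34 × Coherentᵛ s03 s34 s04 × Coherentᵛ s13 s34 s14 ×
  Σ[ s24 ∈ Signs 3 ] Tied s24 × Coherentᵛ s02 s24 s04 × Coherentᵛ s12 s24 s14 × Coherentᵛ s23 s34 s24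

C₅Pattern? : Dec C₅Pattern
C₅Pattern? =
  ∃? λ s13 → Tied? s13 ×-dec
  ∃? λ s03 → Tied? s03 ×-dec
  ∃? λ s01 → Beats? s01 ×-dec coherentᵛ? s01 s13 s03 ×-dec
  ∃? λ s12 → Beats? s12 ×-dec
  ∃? λ s02 → Tied? s02 ×-dec coherentᵛ? s01 s12 s02 ×-dec
  ∃? λ s23 → Beats? s23 ×-dec coherentᵛ? s02 s23 s03 ×-dec coherentᵛ? s12 s23 s13 ×-dec
  ∃? λ s04 → Loses? s04 ×-dec
  ∃? λ s14 → Tied? s14 ×-dec coherentᵛ? s01 s14 s04 ×-dec
  ∃? λ s34 → Beats? s34 ×-dec coherentᵛ? s03 s34 s04 ×-dec coherentᵛ? s13 s34 s14 ×-dec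
  ∃? λ s24 → Tied? s24 ×-dec coherentᵛ? s02 s24 s04 ×-dec coherentᵛ? s12 s24 s14 ×-dec coherentᵛ? s23 s34 s24
  where
  ∃? : Searchable (Signs 3)
  ∃? = search-Vec search-Comparison 3

C₅-dim≢3 : ¬ HasRealizer (Cycle 5) 3
C₅-dim≢3 (f , realizes) = from-no C₅Pattern?
  ( σ v₁ v₃ , tie v₁ v₃ , σ v₀ v₃ , tie v₀ v₃ , σ v₀ v₁ , arc v₀ v₁ , coh v₀ v₁ v₃
  , σ v₁ v₂ , arc v₁ v₂ , σ v₀ v₂ , tie v₀ v₂ , coh v₀ v₁ v₂
  , σ v₂ v₃ , arc v₂ v₃ , coh v₀ v₂ v₃ , coh v₁ v₂ v₃
  , σ v₀ v₄ , Equivalence.to (≺⇔Loses (f v₀) (f v₄)) (proj₁ (realizes v₄ v₀) (inj₂ (refl , refl)))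
  , σ v₁ v₄ , tie v₁ v₄ , coh v₀ v₁ v₄
  , σ v₃ v₄ , arc v₃ v₄ , coh v₀ v₃ v₄ , coh v₁ v₃ v₄
  , σ v₂ v₄ , tie v₂ v₄ , coh v₀ v₂ v₄ , coh v₁ v₂ v₄ , coh v₂ v₃ v₄ )
  where
  v₀ v₁ v₂ v₃ v₄ : Fin 5
  v₀ = # 0
  v₁ = # 1
  v₂ = # 2
  v₃ = # 3
  v₄ = # 4
  σ : Fin 5 → Fin 5 → Signs 3
  σ i j = signs (f i) (f j)
  arc : ∀ i j → {True (Cycle? 5 i j)} → Beats (σ i j)
  arc i j {i→j} = Equivalence.to (≻⇔Beats (f i) (f j)) (proj₁ (realizes i j) (toWitness i→j))
  tie : ∀ i j → {False (Cycle? 5 i j)} → {False (Cycle? 5 j i)} → Tied (σ i j)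
  tie i j {i↛j} {j↛i} = ℕ.≤-antisym (ℕ.≮⇒≥ (¬j≻i ∘ Equivalence.from (≺⇔Loses (f i) (f j))))
                                    (ℕ.≮⇒≥ (¬i≻j ∘ Equivalence.from (≻⇔Beats (f i) (f j))))
    where
    ¬i≻j : ¬ f i ≻ f j
    ¬i≻j = toWitnessFalse i↛j ∘ proj₂ (realizes i j)
    ¬j≻i : ¬ f j ≻ f i
    ¬j≻i = toWitnessFalse j↛i ∘ proj₂ (realizes j i)
  coh : ∀ i j k → Coherentᵛ (σ i j) (σ j k) (σ i k)
  coh i j k = signs-coherent (f i) (f j) (f k)

-- Closing a path into a cycle

arcᵇ : ℕ → ℕ → ℕ → Bool
arcᵇ n a b = (b ≡ᵇ suc a) ∨ ((a ≡ᵇ n ∸ 1) ∧ (b ≡ᵇ 0))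

≡ᵇ-refl : ∀ n → (n ≡ᵇ n) ≡ true
≡ᵇ-refl n = dec-true (n ℕ.≟ n) refl

≡ᵇ-≢ : ∀ {m n} → m ≢ n → (m ≡ᵇ n) ≡ false
≡ᵇ-≢ {m} {n} = dec-false (m ℕ.≟ n)

data Position (N : ℕ) : ℕ → Set where
  first : Position N 0
  inner : ∀ {k} → 1 ≤ k → k ≤ N → Position N k
  last  : Position N (suc N)

position : ∀ {N} a → a < suc (suc N) → Position N a
position zero        _     = first
position {N} (suc k) k<N+2 with k ℕ.<? N
... | yes k<N = inner (s≤s z≤n) k<N
... | no  k≮N = subst (Position N) (cong suc (ℕ.≤-antisym (ℕ.≮⇒≥ k≮N) (ℕ.≤-pred (ℕ.≤-pred k<N+2)))) last

record ClosablePath {V : Set} (_▷_ : V → V → Bool) (N : ℕ) (p q : V) (x : ℕ → V) : Set where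
  field
    along       : ∀ {j k} → 1 ≤ j → j ≤ N → 1 ≤ k → k ≤ N → x j ▷ x k ≡ (k ≡ᵇ suc j)
    from-start  : ∀ {k} → 1 ≤ k → k ≤ N → p ▷ x k ≡ (k ≡ᵇ 1) × x k ▷ p ≡ false
    to-end      : ∀ {k} → 1 ≤ k → k ≤ N → x k ▷ q ≡ (N ≡ᵇ k) × q ▷ x k ≡ false
    wraps       : q ▷ p ≡ true × p ▷ q ≡ false
    irreflexive : p ▷ p ≡ false × q ▷ q ≡ false

module _ {V : Set} {_▷_ : V → V → Bool} {M : ℕ} {p q : V} {x : ℕ → V}
         (closable : ClosablePath _▷_ (suc M) p q x) where
  open ClosablePath closable

  private
    at : ∀ {a} → Position (suc M) a → V
    at first           = p
    at (inner {k} _ _) = x k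
    at last            = q

    arcs : ∀ {a b} (u : Position (suc M) a) (v : Position (suc M) b) → arcᵇ (3 + M) a b ≡ at u ▷ at v
    arcs first first = sym (proj₁ irreflexive)
    arcs first (inner {k} 1≤k k≤N) = trans (∨-identityʳ (k ≡ᵇ 1)) (sym (proj₁ (from-start 1≤k k≤N)))
    arcs first last = sym (proj₂ wraps)
    arcs (inner {j} 1≤j j≤N) first
      rewrite ≡ᵇ-≢ (ℕ.<⇒≢ (s≤s j≤N)) = sym (proj₂ (from-start 1≤j j≤N))
    arcs (inner {j} 1≤j j≤N) (inner {k} 1≤k k≤N)
      rewrite ≡ᵇ-≢ (ℕ.<⇒≢ (s≤s j≤N)) = trans (∨-identityʳ (k ≡ᵇ suc j)) (sym (along 1≤j j≤N 1≤k k≤N))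
    arcs (inner {j} 1≤j j≤N) last
      rewrite ∧-zeroʳ (j ≡ᵇ 2 + M) = trans (∨-identityʳ (suc M ≡ᵇ j)) (sym (proj₁ (to-end 1≤j j≤N)))
    arcs last first
      rewrite ≡ᵇ-refl M = sym (proj₁ wraps)
    arcs last (inner {k} 1≤k k≤N)
      rewrite ≡ᵇ-≢ (ℕ.<⇒≢ (s≤s (ℕ.m≤n⇒m≤1+n k≤N))) | ≡ᵇ-refl M | ≡ᵇ-≢ (ℕ.m<n⇒n≢0 1≤k)
      = sym (proj₂ (to-end 1≤k k≤N))
    arcs last last
      rewrite ≡ᵇ-≢ (ℕ.<⇒≢ (ℕ.n<1+n M)) | ∧-zeroʳ (M ≡ᵇ M) = sym (proj₂ irreflexive)

  vertex : Fin (3 + M) → V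
  vertex i = at (position (toℕ i) (Fin.toℕ<n i))

  closes-cycle : ∀ i j → does (Cycle? (3 + M) i j) ≡ vertex i ▷ vertex j
  closes-cycle i j = arcs (position (toℕ i) (Fin.toℕ<n i)) (position (toℕ j) (Fin.toℕ<n j))

-- A realizer in dimension four

beats : ∀ {d} → Signs d → Bool
beats s = #less s <ᵇ #greater s

T-beats : ∀ {d} (s : Signs d) → T (beats s) ⇔ Beats s
T-beats _ = mk⇔ (ℕ.<ᵇ⇒< _ _) ℕ.<⇒<ᵇ

-- ⟨ a , b , c , e ⟩ stands for the point (−a, −b, c, e).
record Quad : Set where
  constructor ⟨_,_,_,_⟩
  field x₁ x₂ x₃ x₄ : ℕ
open Quad

⟦_⟧ : Quad → Point 4
⟦ ⟨ a , b , c , e ⟩ ⟧ = lookup (ℚ.- ι a ∷ ℚ.- ι b ∷ ι c ∷ ι e ∷ [])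

signsQ : Quad → Quad → Signs 4
signsQ ⟨ a , b , c , e ⟩ ⟨ a′ , b′ , c′ , e′ ⟩ =
  compareℕ a′ a ∷ compareℕ b′ b ∷ compareℕ c c′ ∷ compareℕ e e′ ∷ []

signs-⟦⟧ : ∀ A B → signs ⟦ A ⟧ ⟦ B ⟧ ≡ signsQ A B
signs-⟦⟧ ⟨ a , b , c , e ⟩ ⟨ a′ , b′ , c′ , e′ ⟩ =
  cong₂ _∷_ (compareℚ-−ι a a′) (cong₂ _∷_ (compareℚ-−ι b b′)
    (cong₂ _∷_ (compareℚ-ι c c′) (cong₂ _∷_ (compareℚ-ι e e′) refl)))

_⊳_ : Quad → Quad → Bool
A ⊳ B = beats (signsQ A B)

⊳⇔≻ : ∀ A B → T (A ⊳ B) ⇔ ⟦ A ⟧ ≻ ⟦ B ⟧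
⊳⇔≻ A B = mk⇔
  (λ A⊳B → Equivalence.from (≻⇔Beats ⟦ A ⟧ ⟦ B ⟧)
             (subst Beats (sym (signs-⟦⟧ A B)) (Equivalence.to (T-beats (signsQ A B)) A⊳B)))
  (λ A≻B → Equivalence.from (T-beats (signsQ A B))
             (subst Beats (signs-⟦⟧ A B) (Equivalence.to (≻⇔Beats ⟦ A ⟧ ⟦ B ⟧) A≻B)))

⊳-irrefl : ∀ A → A ⊳ A ≡ false
⊳-irrefl ⟨ a , b , c , e ⟩
  rewrite compareℕ-refl a | compareℕ-refl b | compareℕ-refl c | compareℕ-refl e = refl

Reflects⇒⇔ : ∀ {A : Set} {b} → Reflects A b → A ⇔ T b
Reflects⇒⇔ (ofʸ a)  = mk⇔ (λ _ → tt) (λ _ → a)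
Reflects⇒⇔ (ofⁿ ¬a) = mk⇔ ¬a λ ()

realizer-from-⊳ : ∀ {n} (g : Fin n → Quad) → (∀ i j → does (Cycle? n i j) ≡ g i ⊳ g j) →
                  IsRealizer (Cycle n) 4 (⟦_⟧ ∘ g)
realizer-from-⊳ {n} g arcs i j =
    (λ arc → Equivalence.to (⊳⇔≻ (g i) (g j)) (Equivalence.to arc⇔⊳ arc))
  , (λ gi≻gj → Equivalence.from arc⇔⊳ (Equivalence.from (⊳⇔≻ (g i) (g j)) gi≻gj))
  where
  arc⇔⊳ : Cycle n i j ⇔ T (g i ⊳ g j)
  arc⇔⊳ = Reflects⇒⇔ (subst (Reflects (Cycle n i j)) (arcs i j) (proof (Cycle? n i j)))

step : Quad → Quad
step ⟨ a , b , c , e ⟩ = ⟨ 2 + a , 2 + b , e , 2 + c ⟩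

-- path k = ⟨ 2k , 2k , 2⌊k/2⌋ , 2⌈k/2⌉ ⟩
path : ℕ → Quad
path zero    = ⟨ 0 , 0 , 0 , 0 ⟩
path (suc k) = step (path k)

path-⊳ : ∀ j k → path j ⊳ path k ≡ (k ≡ᵇ suc j)
path-⊳ 0                   0                   = refl
path-⊳ 0                   1                   = refl
path-⊳ 1                   0                   = refl
path-⊳ 1                   1                   = refl
path-⊳ 0                   (suc (suc k))       = refl
path-⊳ 1                   2                   = refl
path-⊳ 1                   (suc (suc (suc k))) = refl
path-⊳ (suc (suc j))       0                   = refl
path-⊳ 2                   1                   = refl
path-⊳ (suc (suc (suc j))) 1                   = refl
path-⊳ (suc (suc j))       (suc (suc k))       = path-⊳ j k

twice : ℕ → ℕ
twice zero    = zero
twice (suc m) = suc (suc (twice m))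

even-end : Quad → Quad
even-end x = ⟨ 0 , suc (x₂ x) , x₃ x , 1 ⟩

even-closable : ∀ m → ClosablePath _⊳_ (2 + twice m) (path 0) (even-end (path (2 + twice m))) path
even-closable m = record
  { along       = λ {j} {k} _ _ _ _ → path-⊳ j k
  ; from-start  = λ {k} _ _ → path-⊳ 0 k , path-⊳ k 0
  ; to-end      = to-end m
  ; wraps       = refl , refl
  ; irreflexive = ⊳-irrefl (path 0) , ⊳-irrefl (even-end (path (2 + twice m)))
  }
  where
  to-end : ∀ m {k} → 1 ≤ k → k ≤ 2 + twice m →
           path k ⊳ even-end (path (2 + twice m)) ≡ (2 + twice m ≡ᵇ k) ×
           even-end (path (2 + twice m)) ⊳ path k ≡ false
  to-end _       {1}                 _ _  = refl , refl
  to-end zero    {2}                 _ _  = refl , refl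
  to-end (suc m) {2}                 _ _  = refl , refl
  to-end (suc m) {suc (suc (suc k))} _ k≤ = to-end m (s≤s z≤n) (ℕ.≤-pred (ℕ.≤-pred k≤))
  to-end zero    {suc (suc (suc k))} _ (s≤s (s≤s ()))

odd-start : Quad
odd-start = ⟨ 5 , 0 , 0 , 3 ⟩

odd-end : Quad → Quad
odd-end x = ⟨ 2 , suc (x₂ x) , 0 , x₄ x ⟩

odd-closable : ∀ m → ClosablePath _⊳_ (3 + twice m) odd-start (odd-end (path (3 + twice m))) path
odd-closable m = record
  { along       = λ {j} {k} _ _ _ _ → path-⊳ j k
  ; from-start  = λ {k} _ _ → from-start k
  ; to-end      = to-end m
  ; wraps       = refl , refl
  ; irreflexive = ⊳-irrefl odd-start , ⊳-irrefl (odd-end (path (3 + twice m)))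
  }
  where
  from-start : ∀ k → odd-start ⊳ path k ≡ (k ≡ᵇ 1) × path k ⊳ odd-start ≡ false
  from-start 0                   = refl , refl
  from-start 1                   = refl , refl
  from-start 2                   = refl , refl
  from-start (suc (suc (suc k))) = refl , refl
  to-end : ∀ m {k} → 1 ≤ k → k ≤ 3 + twice m →
           path k ⊳ odd-end (path (3 + twice m)) ≡ (3 + twice m ≡ᵇ k) ×
           odd-end (path (3 + twice m)) ⊳ path k ≡ false
  to-end _       {1}                       _ _  = refl , refl
  to-end _       {2}                       _ _  = refl , refl
  to-end zero    {3}                       _ _  = refl , refl
  to-end (suc m) {3}                       _ _  = refl , refl
  to-end (suc m) {suc (suc (suc (suc k)))} _ k≤ = to-end m (s≤s z≤n) (ℕ.≤-pred (ℕ.≤-pred k≤))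
  to-end zero    {suc (suc (suc (suc k)))} _ (s≤s (s≤s (s≤s ())))

cycle-realizer-even : ∀ m → HasRealizer (Cycle (4 + twice m)) 4
cycle-realizer-even m = ⟦_⟧ ∘ vertex closable , realizer-from-⊳ (vertex closable) (closes-cycle closable)
  where
  closable : ClosablePath _⊳_ (2 + twice m) (path 0) (even-end (path (2 + twice m))) path
  closable = even-closable m

cycle-realizer-odd : ∀ m → HasRealizer (Cycle (5 + twice m)) 4
cycle-realizer-odd m = ⟦_⟧ ∘ vertex closable , realizer-from-⊳ (vertex closable) (closes-cycle closable)
  where
  closable : ClosablePath _⊳_ (3 + twice m) odd-start (odd-end (path (3 + twice m))) path
  closable = odd-closable m

rotation : Fin 3 → Point 3
rotation i c = ι ((toℕ c + 2 * toℕ i) % 3)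

C₃-realizer : IsRealizer (Cycle 3) 3 rotation
C₃-realizer = from-yes (realizes? (Cycle? 3) 3 rotation)

pad : ∀ {d} → Point d → Point (suc d)
pad x fzero    = ι 0
pad x (fsuc i) = x i

-- The new coordinate is the same for all points, so it adds nothing to countGt, definitionally.
realizer-pad : ∀ {n d} {D : Digraph n} {f : Fin n → Point d} →
               IsRealizer D d f → IsRealizer D (suc d) (pad ∘ f)
realizer-pad realizes = realizes

parity : ∀ k → ∃ λ m → k ≡ twice m ⊎ k ≡ suc (twice m)
parity zero          = zero , inj₁ refl
parity (suc zero)    = zero , inj₂ refl
parity (suc (suc k)) with parity k
... | m , inj₁ refl = suc m , inj₁ refl
... | m , inj₂ refl = suc m , inj₂ refl

cycle-realizer-4 : ∀ {n} → 3 ≤ n → HasRealizer (Cycle n) 4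
cycle-realizer-4 {3} _ = pad ∘ rotation , realizer-pad {f = rotation} C₃-realizer
cycle-realizer-4 {suc (suc (suc (suc k)))} _ with parity k
... | m , inj₁ refl = cycle-realizer-even m
... | m , inj₂ refl = cycle-realizer-odd m
cycle-realizer-4 {1} (s≤s ())
cycle-realizer-4 {2} (s≤s (s≤s ()))

-- The dimension of a cycle

dimension-4 : ∀ {n} {D : Digraph n} → HasRealizer D 4 → (∀ d → HasRealizer D d → 3 ≤ d) →
              ¬ HasRealizer D 3 → DimIs D 4
dimension-4 {D = D} has-4 lower ¬has-3 =
  has-4 , λ d has-d → ℕ.≤∧≢⇒< (lower d has-d) λ 3≡d → ¬has-3 (subst (HasRealizer D) (sym 3≡d) has-d)

cycle-dim≡3⊎4 : ∀ {n d} → 3 ≤ n → DimIs (Cycle n) d → d ≡ 3 ⊎ d ≡ 4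
cycle-dim≡3⊎4 n≥3 (has-d , minimal) =
  Sum.map₁ (λ d<4 → ℕ.≤-antisym (ℕ.≤-pred d<4) (cycle-dim≥3 (ℕ.<⇒≤ n≥3) has-d))
           (ℕ.m≤n⇒m<n∨m≡n (minimal 4 (cycle-realizer-4 n≥3)))

cycle-dim : ∀ {n} → 3 ≤ n → Σ ℕ (DimIs (Cycle n))
cycle-dim {n} n≥3 with hasRealizer? (Cycle? n) 3
... | yes has-3 = 3 , has-3 , λ d → cycle-dim≥3 (ℕ.<⇒≤ n≥3)
... | no ¬has-3 = 4 , dimension-4 (cycle-realizer-4 n≥3) (λ d → cycle-dim≥3 (ℕ.<⇒≤ n≥3)) ¬has-3

theorem4p5 : ((n : ℕ) → n ≥ 3 → (d : ℕ) → DimIs (Cycle n) d → (d ≡ 3) ⊎ (d ≡ 4))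
    × ((n : ℕ) → n ≥ 3 → Σ ℕ (λ d → DimIs (Cycle n) d))
    × Σ ℕ (λ n → (n ≥ 3) × DimIs (Cycle n) 3)
    × Σ ℕ (λ n → (n ≥ 3) × DimIs (Cycle n) 4)
theorem4p5 =
    (λ n n≥3 d → cycle-dim≡3⊎4 n≥3)
  , (λ n → cycle-dim)
  , (3 , ℕ.≤-refl , (rotation , C₃-realizer) , λ d → cycle-dim≥3 (ℕ.n≤1+n 2))
  , (5 , 3≤5 , dimension-4 (cycle-realizer-4 3≤5) (λ d → cycle-dim≥3 (ℕ.<⇒≤ 3≤5)) C₅-dim≢3)
  where
  3≤5 : 3 ≤ 5
  3≤5 = ℕ.m≤m+n 3 2
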